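{- Let $D=xy\frac{\partial}{\partial x}+x^2\frac{\partial}{\partial y}$ be the derivation on Laurent polynomials in $x,y$ with $D(x)=xy$, $D(y)=x^2$, and for a Laurent polynomial $f$ let $\mathrm{Gen}(f,t)=\sum_{n\ge0}D^n(f)\frac{t^n}{n!}$. Then $$\mathrm{Gen}(y,t)=\frac{y\sqrt{y^2-x^2}\cosh\big(t\sqrt{y^2-x^2}\big)-(y^2-x^2)\sinh\big(t\sqrt{y^2-x^2}\big)}{\sqrt{y^2-x^2}\cosh\big(t\sqrt{y^2-x^2}\big)-y\sinh\big(t\sqrt{y^2-x^2}\big)}.$$
   Context: Identities are of formal power series in $t$; with $s=\sqrt{y^2-x^2}$, after dividing numerator and denominator by $s$, $\cosh(ts)=\sum_n s^{2n}t^{2n}/(2n)!$, $\sinh(ts)/s=\sum_n s^{2n}t^{2n+1}/(2n+1)!$ and $s\sinh(ts)=\sum_n s^{2n+2}t^{2n+1}/(2n+1)!$, so only powers of $y^2-x^2$ occur. -}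

module Defs where

open import Data.Nat as ℕ using (ℕ; zero; suc; _!; ⌊_/2⌋; _%_)
open import Data.Nat.Properties using (_!≢0)
open import Data.Integer using (+_)
open import Data.Rational as ℚ using (ℚ; 0ℚ; 1ℚ)

-- Coefficient rings.
-- Poly = ℚ[[x,y]]: an element f is its coefficient function,
-- f i j = coefficient of x^i y^j.  (Contains ℚ[x,y].)

Poly : Set
Poly = ℕ → ℕ → ℚ

Σ< : ℕ → (ℕ → ℚ) → ℚ
Σ< zero    g = 0ℚ
Σ< (suc n) g = Σ< n g ℚ.+ g n

infixl 6 _+ₚ_ _-ₚ_
infixl 7 _*ₚ_ _•_

0ₚ 1ₚ X Y : Poly
0ₚ i j = 0ℚ
1ₚ zero zero = 1ℚ
1ₚ _    _    = 0ℚ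
X (suc zero) zero = 1ℚ
X _          _    = 0ℚ
Y zero (suc zero) = 1ℚ
Y _    _          = 0ℚ

_+ₚ_ _-ₚ_ _*ₚ_ : Poly → Poly → Poly
(f +ₚ g) i j = f i j ℚ.+ g i j
(f -ₚ g) i j = f i j ℚ.- g i j
(f *ₚ g) i j = Σ< (suc i) (λ a → Σ< (suc j) (λ b → f a b ℚ.* g (i ℕ.∸ a) (j ℕ.∸ b)))

_•_ : ℚ → Poly → Poly
(c • f) i j = c ℚ.* f i j

_^ₚ_ : Poly → ℕ → Poly
f ^ₚ zero  = 1ₚ
f ^ₚ suc n = f *ₚ (f ^ₚ n)

∂x ∂y : Poly → Poly
∂x f i j = (+ suc i ℚ./ 1) ℚ.* f (suc i) j
∂y f i j = (+ suc j ℚ./ 1) ℚ.* f i (suc j)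

D : Poly → Poly
D f = (X *ₚ Y) *ₚ ∂x f +ₚ (X *ₚ X) *ₚ ∂y f

D^ : ℕ → Poly → Poly
D^ zero    f = f
D^ (suc n) f = D (D^ n f)

-- Formal power series in t with coefficients in Poly:  F n = [t^n] F

Series : Set
Series = ℕ → Poly

_⋆_ : Series → Series → Series
(F ⋆ G) n i j = Σ< (suc n) (λ k → (F k *ₚ G (n ℕ.∸ k)) i j)

inv! : ℕ → ℚ
inv! n = (+ 1 ℚ./ (n !)) {{n !≢0}}

Gen : Poly → Series
Gen f n = inv! n • D^ n f

s² : Poly
s² = Y *ₚ Y -ₚ X *ₚ X


evenCase : ℕ → Poly → Poly → Poly
evenCase n e o with n % 2
... | zero  = e
... | suc _ = o

-- cosh(ts)      = Σ_m s^{2m} t^{2m} / (2m)!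
coshS : Series
coshS n = evenCase n (inv! n • (s² ^ₚ ⌊ n /2⌋)) 0ₚ

-- sinh(ts)/s    = Σ_m s^{2m} t^{2m+1} / (2m+1)!
sinhS/s : Series
sinhS/s n = evenCase n 0ₚ (inv! n • (s² ^ₚ ⌊ n /2⌋))

-- s·sinh(ts)    = Σ_m s^{2m+2} t^{2m+1} / (2m+1)!
s·sinhS : Series
s·sinhS n = evenCase n 0ₚ (inv! n • (s² ^ₚ suc ⌊ n /2⌋))

-- numerator and denominator of the closed form, both divided by s
Num Den : Series
Num n = Y *ₚ coshS n -ₚ s·sinhS n
Den n = coshS n -ₚ Y *ₚ sinhS/s n

module Submission where

-- Write v = Gen(y,t), C = cosh(ts), S = sinh(ts)/s and u = C − y S in ℚ[[x,y]][[t]], so that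
-- Den = u and Num = −u′.  Because f ↦ Gen f = exp(tD) f is a ring homomorphism turning D into
-- d/dt, and D y = x² = y² − s² with D s² = 0, v solves the Riccati equation v′ = v² − s², while
-- u″ = s² u.  Hence E = v u + u′ satisfies E′ = v E with E(0) = y − y = 0, and E = 0 because a
-- linear ODE over a ring without ℕ-torsion has unique solutions: that is, v·Den = Num.

open import Algebra.Bundles using (CommutativeRing)
open import Algebra.Structures using (IsCommutativeRing)
open import Data.Integer.Base as ℤ using (+_)
import Data.Integer.Properties as ℤ
open import Data.Maybe.Base using (nothing)
open import Data.Nat.Base as ℕ using (ℕ; zero; suc; _!; _%_; ⌊_/2⌋; _∸_; _≤_; _<_; s≤s)
import Data.Nat.Properties as ℕ
open import Data.Nat.Properties
  using (_!≢0; m*n≢0; n∸n≡0; m∸n≤m; +-∸-assoc; m+[n∸m]≡n; ≤-pred; m<n⇒m<1+n; ≤-refl; ≤-<-trans)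
open import Data.Product.Base using (_,_)
open import Data.Rational.Base as ℚ using (1ℚ; 0ℚ; _/_; toℚᵘ)
import Data.Rational.Properties as ℚ
import Data.Rational.Unnormalised.Base as ℚᵘ
import Data.Rational.Unnormalised.Properties as ℚᵘ
open import Function.Base using (_∘_)
open import Level using (_⊔_)
open import Relation.Binary.PropositionalEquality as ≡ using (_≡_)
import Relation.Binary.Reasoning.Setoid

open import Defs

module Derivations {c ℓ} (R : CommutativeRing c ℓ) where
  open CommutativeRing R
  open import Algebra.Properties.Ring ring using (x+x≈x⇒x≈0; x[y-z]≈xy-xz)
  open import Algebra.Properties.Group +-group using (inverseʳ-unique; x≈y⇒x∙y⁻¹≈ε; //-cong₂)
  open import Algebra.Properties.CommutativeSemigroup *-commutativeSemigroup using (x∙yz≈y∙xz)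
  open import Algebra.Properties.CommutativeSemigroup +-commutativeSemigroup using (xy∙z≈xz∙y)
  open import Algebra.Solver.Ring.NaturalCoefficients commutativeSemiring (λ _ _ → nothing)
  open import Relation.Binary.Reasoning.Setoid setoid

  record IsDerivation (∂ : Carrier → Carrier) : Set (c ⊔ ℓ) where
    field
      cong    : ∀ {a b} → a ≈ b → ∂ a ≈ ∂ b
      +-homo  : ∀ a b → ∂ (a + b) ≈ ∂ a + ∂ b
      leibniz : ∀ a b → ∂ (a * b) ≈ ∂ a * b + a * ∂ b

    0-homo : ∂ 0# ≈ 0#
    0-homo = x+x≈x⇒x≈0 (∂ 0#) (trans (sym (+-homo 0# 0#)) (cong (+-identityʳ 0#)))

    -‿homo : ∀ a → ∂ (- a) ≈ - ∂ a
    -‿homo a = inverseʳ-unique (∂ a) (∂ (- a)) (begin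
      ∂ a + ∂ (- a)  ≈⟨ +-homo a (- a) ⟨
      ∂ (a - a)      ≈⟨ cong (-‿inverseʳ a) ⟩
      ∂ 0#           ≈⟨ 0-homo ⟩
      0#             ∎)

    sub-homo : ∀ a b → ∂ (a - b) ≈ ∂ a - ∂ b
    sub-homo a b = trans (+-homo a (- b)) (+-congˡ (-‿homo b))

    constant-*ˡ : ∀ {k} → ∂ k ≈ 0# → ∀ a → ∂ (k * a) ≈ k * ∂ a
    constant-*ˡ {k} ∂k≈0 a = begin
      ∂ (k * a)             ≈⟨ leibniz k a ⟩
      ∂ k * a + k * ∂ a     ≈⟨ +-congʳ (trans (*-congʳ ∂k≈0) (zeroˡ a)) ⟩
      0# + k * ∂ a          ≈⟨ +-identityˡ (k * ∂ a) ⟩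
      k * ∂ a               ∎

  open IsDerivation

  isDerivation-resp : ∀ {∂ ∂′} → (∀ a → ∂ a ≈ ∂′ a) → IsDerivation ∂ → IsDerivation ∂′
  isDerivation-resp {∂} {∂′} ∂≈∂′ isD = record
    { cong    = λ {a} {b} a≈b → trans (sym (∂≈∂′ a)) (trans (cong isD a≈b) (∂≈∂′ b))
    ; +-homo  = λ a b → trans (sym (∂≈∂′ (a + b))) (trans (+-homo isD a b) (+-cong (∂≈∂′ a) (∂≈∂′ b)))
    ; leibniz = λ a b → trans (sym (∂≈∂′ (a * b)))
                          (trans (leibniz isD a b) (+-cong (*-congʳ (∂≈∂′ a)) (*-congˡ (∂≈∂′ b))))
    }

  isDerivation-linearCombination : ∀ {∂₁ ∂₂} (p q : Carrier) → IsDerivation ∂₁ → IsDerivation ∂₂ →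
                                   IsDerivation (λ a → p * ∂₁ a + q * ∂₂ a)
  isDerivation-linearCombination {∂₁} {∂₂} p q isD₁ isD₂ = record
    { cong    = λ a≈b → +-cong (*-congˡ (cong isD₁ a≈b)) (*-congˡ (cong isD₂ a≈b))
    ; +-homo  = λ a b → trans (+-cong (*-congˡ (+-homo isD₁ a b)) (*-congˡ (+-homo isD₂ a b)))
                          (solve 6 (λ p q x y z w → p :* (x :+ y) :+ q :* (z :+ w)
                                                   := (p :* x :+ q :* z) :+ (p :* y :+ q :* w))
                                   refl p q (∂₁ a) (∂₁ b) (∂₂ a) (∂₂ b))
    ; leibniz = λ a b → trans (+-cong (*-congˡ (leibniz isD₁ a b)) (*-congˡ (leibniz isD₂ a b)))
                          (solve 8 (λ p q x y z w a b → p :* (x :* b :+ a :* y) :+ q :* (z :* b :+ a :* w)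
                                                       := (p :* x :+ q :* z) :* b :+ a :* (p :* y :+ q :* w))
                                   refl p q (∂₁ a) (∂₁ b) (∂₂ a) (∂₂ b) a b)
    }

  module _ {∂ : Carrier → Carrier} (isD : IsDerivation ∂) where

    y²-x²-firstIntegral : ∀ x y → ∂ x ≈ x * y → ∂ y ≈ x * x → ∂ (y * y - x * x) ≈ 0#
    y²-x²-firstIntegral x y ∂x ∂y = begin
      ∂ (y * y - x * x)                          ≈⟨ sub-homo isD (y * y) (x * x) ⟩
      ∂ (y * y) - ∂ (x * x)                      ≈⟨ x≈y⇒x∙y⁻¹≈ε (begin
          ∂ (y * y)                              ≈⟨ leibniz isD y y ⟩
          ∂ y * y + y * ∂ y                      ≈⟨ +-cong (*-congʳ ∂y) (*-congˡ ∂y) ⟩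
          (x * x) * y + y * (x * x)              ≈⟨ solve 2 (λ x y → (x :* x) :* y :+ y :* (x :* x)
                                                               := (x :* y) :* x :+ x :* (x :* y)) refl x y ⟩
          (x * y) * x + x * (x * y)              ≈⟨ +-cong (*-congʳ ∂x) (*-congˡ ∂x) ⟨
          ∂ x * x + x * ∂ x                      ≈⟨ leibniz isD x x ⟨
          ∂ (x * x)                              ∎) ⟩
      0#                                         ∎

    -- C and S play the roles of cosh(t√q) and sinh(t√q)/√q.
    module _ {q y C S} (∂q≈0 : ∂ q ≈ 0#) (∂y≈0 : ∂ y ≈ 0#) (∂C≈qS : ∂ C ≈ q * S) (∂S≈C : ∂ S ≈ C) where

      ∂[C-yS] : ∂ (C - y * S) ≈ q * S - y * C
      ∂[C-yS] = begin
        ∂ (C - y * S)      ≈⟨ sub-homo isD C (y * S) ⟩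
        ∂ C - ∂ (y * S)    ≈⟨ //-cong₂ ∂C≈qS (trans (constant-*ˡ isD ∂y≈0 S) (*-congˡ ∂S≈C)) ⟩
        q * S - y * C      ∎

      ∂∂[C-yS] : ∂ (∂ (C - y * S)) ≈ q * (C - y * S)
      ∂∂[C-yS] = begin
        ∂ (∂ (C - y * S))       ≈⟨ cong isD ∂[C-yS] ⟩
        ∂ (q * S - y * C)       ≈⟨ sub-homo isD (q * S) (y * C) ⟩
        ∂ (q * S) - ∂ (y * C)   ≈⟨ //-cong₂ (trans (constant-*ˡ isD ∂q≈0 S) (*-congˡ ∂S≈C))
                                            (trans (constant-*ˡ isD ∂y≈0 C) (*-congˡ ∂C≈qS)) ⟩
        q * C - y * (q * S)     ≈⟨ //-cong₂ refl (x∙yz≈y∙xz y q S) ⟩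
        q * C - q * (y * S)     ≈⟨ x[y-z]≈xy-xz q C (y * S) ⟨
        q * (C - y * S)         ∎

    -- Links the Riccati equation v′ = v² − q to its linearisation u″ = q u.
    riccati : ∀ q v u → ∂ v + q ≈ v * v → ∂ (∂ u) ≈ q * u → ∂ (v * u + ∂ u) ≈ v * (v * u + ∂ u)
    riccati q v u ∂v+q≈v² ∂∂u≈qu = begin
      ∂ (v * u + ∂ u)                    ≈⟨ +-homo isD (v * u) (∂ u) ⟩
      ∂ (v * u) + ∂ (∂ u)                ≈⟨ +-cong (leibniz isD v u) ∂∂u≈qu ⟩
      (∂ v * u + v * ∂ u) + q * u        ≈⟨ xy∙z≈xz∙y (∂ v * u) (v * ∂ u) (q * u) ⟩
      (∂ v * u + q * u) + v * ∂ u        ≈⟨ +-congʳ (trans (sym (distribʳ u (∂ v) q)) (*-congʳ ∂v+q≈v²)) ⟩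
      (v * v) * u + v * ∂ u              ≈⟨ +-congʳ (*-assoc v v u) ⟩
      v * (v * u) + v * ∂ u              ≈⟨ distribˡ v (v * u) (∂ u) ⟨
      v * (v * u + ∂ u)                  ∎

module _ {c ℓ} (R : CommutativeRing c ℓ) where
  open CommutativeRing R
  open import Algebra.Properties.Semiring.Mult semiring using (_×_)

  TorsionFree : Set (c ⊔ ℓ)
  TorsionFree = ∀ n {a} → suc n × a ≈ 0# → a ≈ 0#

module Sums {c ℓ} (R : CommutativeRing c ℓ) where
  open CommutativeRing R

  ∑ : ℕ → (ℕ → Carrier) → Carrier
  ∑ zero    h = 0#
  ∑ (suc n) h = ∑ n h + h n

  ∑-cong : ∀ n {h h′} → (∀ k → k < n → h k ≈ h′ k) → ∑ n h ≈ ∑ n h′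
  ∑-cong zero    h≈h′ = refl
  ∑-cong (suc n) h≈h′ = +-cong (∑-cong n (λ k k<n → h≈h′ k (m<n⇒m<1+n k<n))) (h≈h′ n ≤-refl)

  ∑-zero : ∀ n {h} → (∀ k → k < n → h k ≈ 0#) → ∑ n h ≈ 0#
  ∑-zero n {h} h≈0 = trans (∑-cong n h≈0) (∑-const0 n)
    where
    ∑-const0 : ∀ n → ∑ n (λ _ → 0#) ≈ 0#
    ∑-const0 zero    = refl
    ∑-const0 (suc n) = trans (+-identityʳ _) (∑-const0 n)

  ∑-unfoldˡ : ∀ n h → ∑ (suc n) h ≈ h 0 + ∑ n (h ∘ suc)
  ∑-unfoldˡ zero    h = trans (+-identityˡ (h 0)) (sym (+-identityʳ (h 0)))
  ∑-unfoldˡ (suc n) h = trans (+-congʳ (∑-unfoldˡ n h)) (+-assoc (h 0) _ (h (suc n)))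

  ∑-distrib-+ : ∀ n h h′ → ∑ n (λ k → h k + h′ k) ≈ ∑ n h + ∑ n h′
  ∑-distrib-+ zero    h h′ = sym (+-identityʳ 0#)
  ∑-distrib-+ (suc n) h h′ = trans (+-congʳ (∑-distrib-+ n h h′)) (+-interchange _ _ _ _)
    where open import Algebra.Properties.CommutativeSemigroup +-commutativeSemigroup
            using () renaming (interchange to +-interchange)

  ∑-homo : ∀ (φ : Carrier → Carrier) → φ 0# ≈ 0# → (∀ a b → φ (a + b) ≈ φ a + φ b) →
           ∀ n h → φ (∑ n h) ≈ ∑ n (φ ∘ h)
  ∑-homo φ φ0 φ+ zero    h = φ0
  ∑-homo φ φ0 φ+ (suc n) h = trans (φ+ (∑ n h) (h n)) (+-congʳ (∑-homo φ φ0 φ+ n h))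

  *-distribˡ-∑ : ∀ a n h → a * ∑ n h ≈ ∑ n (λ k → a * h k)
  *-distribˡ-∑ a = ∑-homo (a *_) (zeroʳ a) (distribˡ a)

module FormalPowerSeries {c ℓ} (R : CommutativeRing c ℓ) where
  open CommutativeRing R
  open Sums R public
  open import Algebra.Properties.Ring ring using (x[y-z]≈xy-xz)
  open import Algebra.Properties.Group +-group using (x∙y⁻¹≈ε⇒x≈y; x≈y⇒x∙y⁻¹≈ε; //-cong₂)
  open import Algebra.Properties.Semiring.Mult semiring
    using (_×_; ×-congʳ; ×-congˡ; ×-assoc-*; ×-comm-*; ×-homo-+)
  open import Algebra.Properties.CommutativeMonoid.Mult +-commutativeMonoid using (×-distrib-+)
  open import Relation.Binary.Reasoning.Setoid setoid

  PowerSeries : Set c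
  PowerSeries = ℕ → Carrier

  infix  4 _≋_
  infixl 6 _⊕_
  infixl 7 _⊛_ _·_
  infix  8 ⊝_

  -- A record rather than ∀ n → f n ≈ g n, so that unification never unfolds an equation between
  -- series into one between their (reduced) coefficients.
  record _≋_ (f g : PowerSeries) : Set ℓ where
    constructor coeffwise
    field coeff : ∀ n → f n ≈ g n
  open _≋_ public

  ≋-refl : ∀ {f} → f ≋ f
  ≋-refl = coeffwise λ _ → refl

  _⊕_ : PowerSeries → PowerSeries → PowerSeries
  (f ⊕ g) n = f n + g n

  ⊝_ : PowerSeries → PowerSeries
  (⊝ f) n = - f n

  _·_ : Carrier → PowerSeries → PowerSeries
  (a · f) n = a * f n

  _⊛_ : PowerSeries → PowerSeries → PowerSeries
  (f ⊛ g) n = ∑ (suc n) (λ k → f k * g (n ∸ k))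

  const : Carrier → PowerSeries
  const a zero    = a
  const a (suc n) = 0#

  0s 1s : PowerSeries
  0s _ = 0#
  1s   = const 1#

  tail : PowerSeries → PowerSeries
  tail f = f ∘ suc

  ⊛-cong : ∀ {f f′ g g′} → f ≋ f′ → g ≋ g′ → f ⊛ g ≋ f′ ⊛ g′
  coeff (⊛-cong f≋f′ g≋g′) n = ∑-cong (suc n) (λ k _ → *-cong (coeff f≋f′ k) (coeff g≋g′ (n ∸ k)))

  ⊛-head : ∀ f g → (f ⊛ g) 0 ≈ f 0 * g 0
  ⊛-head f g = +-identityˡ (f 0 * g 0)

  ⊛-unfoldˡ : ∀ f g n → (f ⊛ g) (suc n) ≈ f 0 * g (suc n) + (tail f ⊛ g) n
  ⊛-unfoldˡ f g n = ∑-unfoldˡ (suc n) (λ k → f k * g (suc n ∸ k))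

  ⊛-unfoldʳ : ∀ f g n → (f ⊛ g) (suc n) ≈ (f ⊛ tail g) n + f (suc n) * g 0
  ⊛-unfoldʳ f g n = +-cong
    (∑-cong (suc n) (λ k k<1+n → *-congˡ (reflexive (≡.cong g (+-∸-assoc 1 (≤-pred k<1+n))))))
    (*-congˡ (reflexive (≡.cong g (n∸n≡0 n))))

  ⊛-zeroˡ : ∀ f → 0s ⊛ f ≋ 0s
  coeff (⊛-zeroˡ f) n = ∑-zero (suc n) (λ k _ → zeroˡ (f (n ∸ k)))

  const-⊛ : ∀ a f → const a ⊛ f ≋ a · f
  coeff (const-⊛ a f) zero    = ⊛-head (const a) f
  coeff (const-⊛ a f) (suc n) = begin
    (const a ⊛ f) (suc n)         ≈⟨ ⊛-unfoldˡ (const a) f n ⟩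
    a * f (suc n) + (0s ⊛ f) n    ≈⟨ +-congˡ (coeff (⊛-zeroˡ f) n) ⟩
    a * f (suc n) + 0#            ≈⟨ +-identityʳ _ ⟩
    a * f (suc n)                 ∎

  ⊛-distribʳ : ∀ f g h → (f ⊕ g) ⊛ h ≋ f ⊛ h ⊕ g ⊛ h
  coeff (⊛-distribʳ f g h) n = trans (∑-cong (suc n) (λ k _ → distribʳ _ _ _)) (∑-distrib-+ (suc n) _ _)

  ·-⊛ : ∀ a f g → (a · f) ⊛ g ≋ a · (f ⊛ g)
  coeff (·-⊛ a f g) n = trans (∑-cong (suc n) (λ k _ → *-assoc _ _ _)) (sym (*-distribˡ-∑ a (suc n) _))

  ⊛-comm : ∀ f g → f ⊛ g ≋ g ⊛ f
  coeff (⊛-comm f g) zero    = trans (⊛-head f g) (trans (*-comm (f 0) (g 0)) (sym (⊛-head g f)))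
  coeff (⊛-comm f g) (suc n) = begin
    (f ⊛ g) (suc n)                   ≈⟨ ⊛-unfoldˡ f g n ⟩
    f 0 * g (suc n) + (tail f ⊛ g) n  ≈⟨ +-cong (*-comm _ _) (coeff (⊛-comm (tail f) g) n) ⟩
    g (suc n) * f 0 + (g ⊛ tail f) n  ≈⟨ +-comm _ _ ⟩
    (g ⊛ tail f) n + g (suc n) * f 0  ≈⟨ ⊛-unfoldʳ g f n ⟨
    (g ⊛ f) (suc n)                   ∎

  ⊛-assoc : ∀ f g h → (f ⊛ g) ⊛ h ≋ f ⊛ (g ⊛ h)
  coeff (⊛-assoc f g h) zero = begin
    ((f ⊛ g) ⊛ h) 0    ≈⟨ trans (⊛-head (f ⊛ g) h) (*-congʳ (⊛-head f g)) ⟩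
    (f 0 * g 0) * h 0  ≈⟨ *-assoc _ _ _ ⟩
    f 0 * (g 0 * h 0)  ≈⟨ trans (⊛-head f (g ⊛ h)) (*-congˡ (⊛-head g h)) ⟨
    (f ⊛ (g ⊛ h)) 0    ∎
  coeff (⊛-assoc f g h) (suc n) = begin
    ((f ⊛ g) ⊛ h) (suc n)
      ≈⟨ ⊛-unfoldˡ (f ⊛ g) h n ⟩
    (f ⊛ g) 0 * h (suc n) + (tail (f ⊛ g) ⊛ h) n
      ≈⟨ +-cong (*-congʳ (⊛-head f g)) (coeff (⊛-cong (coeffwise (⊛-unfoldˡ f g)) (≋-refl {h})) n) ⟩
    (f 0 * g 0) * h (suc n) + ((f 0 · tail g ⊕ tail f ⊛ g) ⊛ h) n
      ≈⟨ +-cong (*-assoc _ _ _) (coeff (⊛-distribʳ (f 0 · tail g) (tail f ⊛ g) h) n) ⟩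
    f 0 * (g 0 * h (suc n)) + (((f 0 · tail g) ⊛ h) n + ((tail f ⊛ g) ⊛ h) n)
      ≈⟨ +-congˡ (+-cong (coeff (·-⊛ (f 0) (tail g) h) n) (coeff (⊛-assoc (tail f) g h) n)) ⟩
    f 0 * (g 0 * h (suc n)) + (f 0 * (tail g ⊛ h) n + (tail f ⊛ (g ⊛ h)) n)
      ≈⟨ +-assoc _ _ _ ⟨
    (f 0 * (g 0 * h (suc n)) + f 0 * (tail g ⊛ h) n) + (tail f ⊛ (g ⊛ h)) n
      ≈⟨ +-congʳ (trans (sym (distribˡ _ _ _)) (*-congˡ (sym (⊛-unfoldˡ g h n)))) ⟩
    f 0 * (g ⊛ h) (suc n) + (tail f ⊛ (g ⊛ h)) n
      ≈⟨ ⊛-unfoldˡ f (g ⊛ h) n ⟨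
    (f ⊛ (g ⊛ h)) (suc n) ∎

  ⊛-identityˡ : ∀ f → 1s ⊛ f ≋ f
  coeff (⊛-identityˡ f) n = trans (coeff (const-⊛ 1# f) n) (*-identityˡ (f n))

  powerSeries-isCommutativeRing : IsCommutativeRing _≋_ _⊕_ _⊛_ ⊝_ 0s 1s
  powerSeries-isCommutativeRing = record
    { isRing = record
      { +-isAbelianGroup = record
        { isGroup = record
          { isMonoid = record
            { isSemigroup = record
              { isMagma = record
                { isEquivalence = record
                  { refl  = ≋-refl
                  ; sym   = λ f≋g → coeffwise λ n → sym (coeff f≋g n)
                  ; trans = λ f≋g g≋h → coeffwise λ n → trans (coeff f≋g n) (coeff g≋h n)
                  }
                ; ∙-cong = λ f≋f′ g≋g′ → coeffwise λ n → +-cong (coeff f≋f′ n) (coeff g≋g′ n)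
                }
              ; assoc = λ f g h → coeffwise λ n → +-assoc (f n) (g n) (h n)
              }
            ; identity = (λ f → coeffwise λ n → +-identityˡ (f n)) , (λ f → coeffwise λ n → +-identityʳ (f n))
            }
          ; inverse = (λ f → coeffwise λ n → -‿inverseˡ (f n)) , (λ f → coeffwise λ n → -‿inverseʳ (f n))
          ; ⁻¹-cong = λ f≋g → coeffwise λ n → -‿cong (coeff f≋g n)
          }
        ; comm = λ f g → coeffwise λ n → +-comm (f n) (g n)
        }
      ; *-cong     = ⊛-cong
      ; *-assoc    = ⊛-assoc
      ; *-identity = ⊛-identityˡ
                   , (λ f → coeffwise λ n → trans (coeff (⊛-comm f 1s) n) (coeff (⊛-identityˡ f) n))
      ; distrib    = (λ h f g → coeffwise λ n →
                        trans (coeff (⊛-comm h (f ⊕ g)) n)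
                        (trans (coeff (⊛-distribʳ f g h) n) (+-cong (coeff (⊛-comm f h) n) (coeff (⊛-comm g h) n))))
                   , (λ h f g → ⊛-distribʳ f g h)
      }
    ; *-comm = ⊛-comm
    }

  powerSeriesRing : CommutativeRing c ℓ
  powerSeriesRing = record { isCommutativeRing = powerSeries-isCommutativeRing }

  open Derivations powerSeriesRing using (IsDerivation)
  open import Algebra.Properties.Semiring.Mult (CommutativeRing.semiring powerSeriesRing)
    using () renaming (_×_ to _×ₛ_)

  ×-pointwise : ∀ n f k → (n ×ₛ f) k ≈ n × f k
  ×-pointwise zero    f k = refl
  ×-pointwise (suc n) f k = +-congˡ (×-pointwise n f k)

  ∑-pointwise : ∀ n F k → Sums.∑ powerSeriesRing n F k ≈ ∑ n (λ m → F m k)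
  ∑-pointwise zero    F k = refl
  ∑-pointwise (suc n) F k = +-congʳ (∑-pointwise n F k)

  ×-zeroʳ : ∀ n → n × 0# ≈ 0#
  ×-zeroʳ n = begin
    n × 0#          ≈⟨ ×-congʳ n (zeroˡ 0#) ⟨
    n × (0# * 0#)   ≈⟨ ×-assoc-* n 0# 0# ⟨
    (n × 0#) * 0#   ≈⟨ zeroʳ (n × 0#) ⟩
    0#              ∎

  ×≈×1* : ∀ n a → n × a ≈ (n × 1#) * a
  ×≈×1* n a = trans (×-congʳ n (sym (*-identityˡ a))) (sym (×-assoc-* n 1# a))

  -- The Euler operator t d/dt; it is a derivation because n = k + (n ∸ k) in each term of a product.
  θ : PowerSeries → PowerSeries
  θ f n = n × f n

  θ-leibniz : ∀ f g → θ (f ⊛ g) ≋ θ f ⊛ g ⊕ f ⊛ θ g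
  coeff (θ-leibniz f g) n = begin
    n × ∑ (suc n) (λ k → f k * g (n ∸ k))
      ≈⟨ ∑-homo (n ×_) (×-zeroʳ n) (λ a b → ×-distrib-+ a b n) (suc n) _ ⟩
    ∑ (suc n) (λ k → n × (f k * g (n ∸ k)))
      ≈⟨ ∑-cong (suc n) (λ k k<1+n → split k (≤-pred k<1+n)) ⟩
    ∑ (suc n) (λ k → (k × f k) * g (n ∸ k) + f k * ((n ∸ k) × g (n ∸ k)))
      ≈⟨ ∑-distrib-+ (suc n) _ _ ⟩
    (θ f ⊛ g) n + (f ⊛ θ g) n
      ∎
    where
    split : ∀ k → k ≤ n → n × (f k * g (n ∸ k)) ≈ (k × f k) * g (n ∸ k) + f k * ((n ∸ k) × g (n ∸ k))
    split k k≤n = begin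
      n × (f k * g (n ∸ k))                                 ≈⟨ ×-congˡ (≡.sym (m+[n∸m]≡n k≤n)) ⟩
      (k ℕ.+ (n ∸ k)) × (f k * g (n ∸ k))                   ≈⟨ ×-homo-+ _ k (n ∸ k) ⟩
      k × (f k * g (n ∸ k)) + (n ∸ k) × (f k * g (n ∸ k))   ≈⟨ +-cong (×-assoc-* k _ _) (×-comm-* (n ∸ k) _ _) ⟨
      (k × f k) * g (n ∸ k) + f k * ((n ∸ k) × g (n ∸ k))   ∎

  d : PowerSeries → PowerSeries
  d f n = suc n × f (suc n)

  θ-⊛-unfold : ∀ f g n → (θ f ⊛ g) (suc n) ≈ (d f ⊛ g) n
  θ-⊛-unfold f g n = begin
    (θ f ⊛ g) (suc n)              ≈⟨ ⊛-unfoldˡ (θ f) g n ⟩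
    0# * g (suc n) + (d f ⊛ g) n   ≈⟨ +-congʳ (zeroˡ (g (suc n))) ⟩
    0# + (d f ⊛ g) n               ≈⟨ +-identityˡ _ ⟩
    (d f ⊛ g) n                    ∎

  d-const : ∀ a → d (const a) ≋ 0s
  coeff (d-const a) n = ×-zeroʳ (suc n)

  d-isDerivation : IsDerivation d
  d-isDerivation = record
    { cong    = λ f≋g → coeffwise λ n → ×-congʳ (suc n) (coeff f≋g (suc n))
    ; +-homo  = λ f g → coeffwise λ n → ×-distrib-+ (f (suc n)) (g (suc n)) (suc n)
    ; leibniz = λ f g → coeffwise λ n → begin
        d (f ⊛ g) n                              ≈⟨ coeff (θ-leibniz f g) (suc n) ⟩
        (θ f ⊛ g) (suc n) + (f ⊛ θ g) (suc n)    ≈⟨ +-cong (θ-⊛-unfold f g n)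
                                                      (trans (coeff (⊛-comm f (θ g)) (suc n))
                                                        (trans (θ-⊛-unfold g f n) (coeff (⊛-comm (d g) f) n))) ⟩
        (d f ⊛ g) n + (f ⊛ d g) n                ∎
    }

  map : (Carrier → Carrier) → PowerSeries → PowerSeries
  map ∂ f = ∂ ∘ f

  map-isDerivation : ∀ {∂} → Derivations.IsDerivation R ∂ → IsDerivation (map ∂)
  map-isDerivation {∂} isD = record
    { cong    = λ f≋g → coeffwise λ n → cong (coeff f≋g n)
    ; +-homo  = λ f g → coeffwise λ n → +-homo (f n) (g n)
    ; leibniz = λ f g → coeffwise λ n → begin
        ∂ (∑ (suc n) (λ k → f k * g (n ∸ k)))
          ≈⟨ ∑-homo ∂ 0-homo +-homo (suc n) _ ⟩
        ∑ (suc n) (λ k → ∂ (f k * g (n ∸ k)))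
          ≈⟨ ∑-cong (suc n) (λ k _ → leibniz (f k) (g (n ∸ k))) ⟩
        ∑ (suc n) (λ k → ∂ (f k) * g (n ∸ k) + f k * ∂ (g (n ∸ k)))
          ≈⟨ ∑-distrib-+ (suc n) _ _ ⟩
        (map ∂ f ⊛ g) n + (f ⊛ map ∂ g) n
          ∎
    }
    where open Derivations.IsDerivation isD

  -- The properties of Φ a = Σₙ ∂ⁿ(a) tⁿ/n! that determine it over a torsion-free ring.
  record IsExponentialOf (∂ : Carrier → Carrier) (Φ : Carrier → PowerSeries) : Set (c ⊔ ℓ) where
    field
      cong    : ∀ {a b} → a ≈ b → Φ a ≋ Φ b
      +-homo  : ∀ a b → Φ (a + b) ≋ Φ a ⊕ Φ b
      head    : ∀ a → Φ a 0 ≈ a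
      d-homo  : ∀ a → d (Φ a) ≋ Φ (∂ a)

    0-homo : Φ 0# ≋ 0s
    0-homo = x+x≈x⇒x≈0 (Φ 0#)
      (coeffwise λ n → trans (sym (coeff (+-homo 0# 0#) n)) (coeff (cong (+-identityʳ 0#)) n))
      where open import Algebra.Properties.Ring (CommutativeRing.ring powerSeriesRing) using (x+x≈x⇒x≈0)

  module _ (torsionFree : TorsionFree R) where

    powerSeries-torsionFree : TorsionFree powerSeriesRing
    coeff (powerSeries-torsionFree n [n+1]f≋0) k =
      torsionFree n (trans (sym (×-pointwise (suc n) _ k)) (coeff [n+1]f≋0 k))

    d-injective : ∀ {f g} n → d f n ≈ d g n → f (suc n) ≈ g (suc n)
    d-injective {f} {g} n df≈dg = x∙y⁻¹≈ε⇒x≈y _ _ (torsionFree n (begin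
      suc n × (f (suc n) - g (suc n))         ≈⟨ ×≈×1* (suc n) _ ⟩
      (suc n × 1#) * (f (suc n) - g (suc n))  ≈⟨ x[y-z]≈xy-xz _ _ _ ⟩
      (suc n × 1#) * f (suc n) - (suc n × 1#) * g (suc n)
                                              ≈⟨ //-cong₂ (×≈×1* (suc n) _) (×≈×1* (suc n) _) ⟨
      d f n - d g n                           ≈⟨ x≈y⇒x∙y⁻¹≈ε df≈dg ⟩
      0#                                      ∎))

    ode-uniqueness : ∀ {f} g → f 0 ≈ 0# → d f ≋ g ⊛ f → f ≋ 0s
    coeff (ode-uniqueness {f} g f₀≈0 df≋gf) n = vanishesBelow (suc n) n ≤-refl
      where
      vanishesBelow : ∀ m k → k < m → f k ≈ 0#
      vanishesBelow (suc m) zero    _         = f₀≈0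
      vanishesBelow (suc m) (suc k) (s≤s k<m) = torsionFree k (begin
        suc k × f (suc k)   ≈⟨ coeff df≋gf k ⟩
        (g ⊛ f) k           ≈⟨ ∑-zero (suc k) (λ j _ → trans
                                 (*-congˡ (vanishesBelow m (k ∸ j) (≤-<-trans (m∸n≤m k j) k<m))) (zeroʳ (g j))) ⟩
        0#                  ∎)

    module _ {∂ : Carrier → Carrier} (∂-isDerivation : Derivations.IsDerivation R ∂)
             {Φ : Carrier → PowerSeries} (Φ-isExponential : IsExponentialOf ∂ Φ) where
      open IsExponentialOf Φ-isExponential
      open Derivations.IsDerivation ∂-isDerivation using (leibniz)
      open Derivations.IsDerivation d-isDerivation using () renaming (leibniz to d-leibniz)

      exponential-*-homo : ∀ a b → Φ (a * b) ≋ Φ a ⊛ Φ b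
      coeff (exponential-*-homo a b) zero    = begin
        Φ (a * b) 0         ≈⟨ head (a * b) ⟩
        a * b               ≈⟨ *-cong (head a) (head b) ⟨
        Φ a 0 * Φ b 0       ≈⟨ ⊛-head (Φ a) (Φ b) ⟨
        (Φ a ⊛ Φ b) 0       ∎
      coeff (exponential-*-homo a b) (suc n) = d-injective {Φ (a * b)} {Φ a ⊛ Φ b} n (begin
        d (Φ (a * b)) n                          ≈⟨ coeff (d-homo (a * b)) n ⟩
        Φ (∂ (a * b)) n                          ≈⟨ coeff (cong (leibniz a b)) n ⟩
        Φ (∂ a * b + a * ∂ b) n                  ≈⟨ coeff (+-homo (∂ a * b) (a * ∂ b)) n ⟩
        Φ (∂ a * b) n + Φ (a * ∂ b) n            ≈⟨ +-cong (coeff (exponential-*-homo (∂ a) b) n)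
                                                           (coeff (exponential-*-homo a (∂ b)) n) ⟩
        (Φ (∂ a) ⊛ Φ b) n + (Φ a ⊛ Φ (∂ b)) n    ≈⟨ +-cong (coeff (⊛-cong (d-homo a) (≋-refl {Φ b})) n)
                                                           (coeff (⊛-cong (≋-refl {Φ a}) (d-homo b)) n) ⟨
        (d (Φ a) ⊛ Φ b) n + (Φ a ⊛ d (Φ b)) n    ≈⟨ coeff (d-leibniz (Φ a) (Φ b)) n ⟨
        d (Φ a ⊛ Φ b) n                          ∎)

      exponential-const : ∀ {a} → ∂ a ≈ 0# → Φ a ≋ const a
      coeff (exponential-const {a} ∂a≈0) zero    = head a
      coeff (exponential-const {a} ∂a≈0) (suc n) = d-injective {Φ a} {const a} n (begin
        d (Φ a) n       ≈⟨ coeff (d-homo a) n ⟩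
        Φ (∂ a) n       ≈⟨ coeff (cong ∂a≈0) n ⟩
        Φ 0# n          ≈⟨ coeff 0-homo n ⟩
        0#              ≈⟨ coeff (d-const a) n ⟨
        d (const a) n   ∎)

open import Algebra.Properties.Semiring.Mult (CommutativeRing.semiring ℚ.+-*-commutativeRing)
  using (_×_; ×-assoc-*)

toℚᵘ-/ : ∀ i m .{{_ : ℕ.NonZero m}} → toℚᵘ (i / m) ℚᵘ.≃ i ℚᵘ./ m
toℚᵘ-/ i (suc m) = ℚ.toℚᵘ-fromℚᵘ (ℚᵘ.mkℚᵘ i m)

suc/1≡1+/1 : ∀ n → + suc n / 1 ≡ 1ℚ ℚ.+ + n / 1
suc/1≡1+/1 n = ℚ.toℚᵘ-injective (begin
  toℚᵘ (+ suc n / 1)                     ≈⟨ toℚᵘ-/ (+ suc n) 1 ⟩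
  ℚᵘ.mkℚᵘ (+ suc n) 0                    ≈⟨ ℚᵘ.*≡* cross ⟩
  ℚᵘ.1ℚᵘ ℚᵘ.+ ℚᵘ.mkℚᵘ (+ n) 0            ≈⟨ ℚᵘ.+-cong (ℚᵘ.≃-sym (toℚᵘ-/ (+ 1) 1)) (ℚᵘ.≃-sym (toℚᵘ-/ (+ n) 1)) ⟩
  toℚᵘ 1ℚ ℚᵘ.+ toℚᵘ (+ n / 1)            ≈⟨ ℚ.toℚᵘ-homo-+ 1ℚ (+ n / 1) ⟨
  toℚᵘ (1ℚ ℚ.+ + n / 1)                  ∎)
  where
  open import Relation.Binary.Reasoning.Setoid ℚᵘ.≃-setoid
  cross : + suc n ℤ.* + 1 ≡ (+ 1 ℤ.* + 1 ℤ.+ + n ℤ.* + 1) ℤ.* + 1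
  cross = ≡.trans (ℤ.*-identityʳ (+ suc n))
                (≡.sym (≡.trans (ℤ.*-identityʳ _) (≡.cong (λ z → + 1 ℤ.+ z) (ℤ.*-identityʳ (+ n)))))

×≡/1* : ∀ n p → n × p ≡ (+ n / 1) ℚ.* p
×≡/1* zero    p = ≡.sym (ℚ.*-zeroˡ p)
×≡/1* (suc n) p = begin
  p ℚ.+ n × p                       ≡⟨ ≡.cong (p ℚ.+_) (×≡/1* n p) ⟩
  p ℚ.+ (+ n / 1) ℚ.* p             ≡⟨ ≡.cong (ℚ._+ (+ n / 1) ℚ.* p) (ℚ.*-identityˡ p) ⟨
  1ℚ ℚ.* p ℚ.+ (+ n / 1) ℚ.* p      ≡⟨ ℚ.*-distribʳ-+ p 1ℚ (+ n / 1) ⟨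
  (1ℚ ℚ.+ + n / 1) ℚ.* p            ≡⟨ ≡.cong (ℚ._* p) (suc/1≡1+/1 n) ⟨
  (+ suc n / 1) ℚ.* p               ∎
  where open ≡.≡-Reasoning

suc×inv!≡inv! : ∀ n → suc n × inv! (suc n) ≡ inv! n
suc×inv!≡inv! n = ≡.trans (×≡/1* (suc n) (inv! (suc n))) (ℚ.toℚᵘ-injective (begin
  toℚᵘ ((+ suc n / 1) ℚ.* inv! (suc n))                 ≈⟨ ℚ.toℚᵘ-homo-* (+ suc n / 1) (inv! (suc n)) ⟩
  toℚᵘ (+ suc n / 1) ℚᵘ.* toℚᵘ (inv! (suc n))
                                    ≈⟨ ℚᵘ.*-cong (toℚᵘ-/ (+ suc n) 1) (toℚᵘ-/ (+ 1) (suc n !) {{suc n !≢0}}) ⟩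
  ℚᵘ.mkℚᵘ (+ suc n) 0 ℚᵘ.* (+ 1 ℚᵘ./ (suc n ℕ.* n !)) {{suc n !≢0}}
                                                        ≈⟨ cancel (n !) {{n !≢0}} ⟩
  (+ 1 ℚᵘ./ n !) {{n !≢0}}                              ≈⟨ toℚᵘ-/ (+ 1) (n !) {{n !≢0}} ⟨
  toℚᵘ (inv! n)                                         ∎))
  where
  open import Relation.Binary.Reasoning.Setoid ℚᵘ.≃-setoid
  cancel : ∀ m .{{_ : ℕ.NonZero m}} →
           ℚᵘ.mkℚᵘ (+ suc n) 0 ℚᵘ.* (+ 1 ℚᵘ./ (suc n ℕ.* m)) {{m*n≢0 (suc n) m}} ℚᵘ.≃ + 1 ℚᵘ./ m
  cancel (suc m) = ℚᵘ.*≡* (≡.trans (≡.cong (ℤ._* + suc m) (ℤ.*-identityʳ (+ suc n)))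
    (≡.trans (ℤ.pos-* (suc n) (suc m)) (≡.sym (≡.trans (ℤ.*-identityˡ _) (≡.cong +_ (ℕ.*-identityˡ _))))))

suc×[inv!*p]≡inv!*p : ∀ n p → suc n × (inv! (suc n) ℚ.* p) ≡ inv! n ℚ.* p
suc×[inv!*p]≡inv!*p n p = begin
  suc n × (inv! (suc n) ℚ.* p)   ≡⟨ ×-assoc-* (suc n) (inv! (suc n)) p ⟨
  (suc n × inv! (suc n)) ℚ.* p   ≡⟨ ≡.cong (ℚ._* p) (suc×inv!≡inv! n) ⟩
  inv! n ℚ.* p                   ∎
  where open ≡.≡-Reasoning

ℚ-torsionFree : TorsionFree ℚ.+-*-commutativeRing
ℚ-torsionFree n {a} [n+1]a≡0 = begin
  a                         ≡⟨ ℚ.*-identityˡ a ⟨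
  1ℚ ℚ.* a                  ≡⟨ ≡.cong (ℚ._* a) (ℚ.*-inverseˡ p) ⟨
  ℚ.1/ p ℚ.* p ℚ.* a        ≡⟨ ℚ.*-assoc (ℚ.1/ p) p a ⟩
  ℚ.1/ p ℚ.* (p ℚ.* a)      ≡⟨ ≡.cong (ℚ.1/ p ℚ.*_) (≡.trans (≡.sym (×≡/1* (suc n) a)) [n+1]a≡0) ⟩
  ℚ.1/ p ℚ.* 0ℚ             ≡⟨ ℚ.*-zeroʳ (ℚ.1/ p) ⟩
  0ℚ                        ∎
  where
  open ≡.≡-Reasoning
  p = + suc n / 1
  instance
    p≢0 : ℚ.NonZero p
    p≢0 = ℚ.pos⇒nonZero p {{ℚ.normalize-pos (suc n) 1}}

-- Poly is ℚ⟦y⟧⟦x⟧ (f i j is the coefficient of xⁱ yʲ) and Series is Poly⟦t⟧.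
module ℚ⟦y⟧ = FormalPowerSeries ℚ.+-*-commutativeRing
module ℚ⟦x,y⟧ = FormalPowerSeries ℚ⟦y⟧.powerSeriesRing
module ℚ⟦x,y⟧⟦t⟧ = FormalPowerSeries ℚ⟦x,y⟧.powerSeriesRing

Poly-torsionFree : TorsionFree ℚ⟦x,y⟧.powerSeriesRing
Poly-torsionFree = ℚ⟦x,y⟧.powerSeries-torsionFree (ℚ⟦y⟧.powerSeries-torsionFree ℚ-torsionFree)

Σ<≡∑ : ∀ n h → Σ< n h ≡ ℚ⟦y⟧.∑ n h
Σ<≡∑ zero    h = ≡.refl
Σ<≡∑ (suc n) h = ≡.cong (ℚ._+ h n) (Σ<≡∑ n h)

data Parity (n : ℕ) : Set where
  even : n % 2 ≡ 0 → suc n % 2 ≡ 1 → ⌊ suc n /2⌋ ≡ ⌊ n /2⌋ → Parity n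
  odd  : n % 2 ≡ 1 → suc n % 2 ≡ 0 → ⌊ suc n /2⌋ ≡ suc ⌊ n /2⌋ → Parity n

-- parity (suc n) only swaps components, since suc (suc n) % 2 reduces to n % 2.
parity : ∀ n → Parity n
parity zero    = even ≡.refl ≡.refl ≡.refl
parity (suc n) with parity n
... | even n%2≡0 1+n%2≡1 ⌊1+n/2⌋≡⌊n/2⌋ = odd 1+n%2≡1 n%2≡0 (≡.cong suc (≡.sym ⌊1+n/2⌋≡⌊n/2⌋))
... | odd n%2≡1 1+n%2≡0 ⌊1+n/2⌋≡1+⌊n/2⌋ = even 1+n%2≡0 n%2≡1 (≡.sym ⌊1+n/2⌋≡1+⌊n/2⌋)

cosh-coeff sinh/s-coeff s·sinh-coeff : ℕ → Poly
cosh-coeff   n = evenCase n (s² ^ₚ ⌊ n /2⌋) 0ₚ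
sinh/s-coeff n = evenCase n 0ₚ (s² ^ₚ ⌊ n /2⌋)
s·sinh-coeff n = evenCase n 0ₚ (s² ^ₚ suc ⌊ n /2⌋)

cosh-coeff-suc : ∀ n → cosh-coeff (suc n) ≡ s·sinh-coeff n
cosh-coeff-suc n with parity n
... | even n%2≡0 1+n%2≡1 _              rewrite n%2≡0 | 1+n%2≡1 = ≡.refl
... | odd n%2≡1 1+n%2≡0 ⌊1+n/2⌋≡1+⌊n/2⌋ rewrite n%2≡1 | 1+n%2≡0 | ⌊1+n/2⌋≡1+⌊n/2⌋ = ≡.refl

sinh/s-coeff-suc : ∀ n → sinh/s-coeff (suc n) ≡ cosh-coeff n
sinh/s-coeff-suc n with parity n
... | even n%2≡0 1+n%2≡1 ⌊1+n/2⌋≡⌊n/2⌋ rewrite n%2≡0 | 1+n%2≡1 | ⌊1+n/2⌋≡⌊n/2⌋ = ≡.refl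
... | odd n%2≡1 1+n%2≡0 _              rewrite n%2≡1 | 1+n%2≡0 = ≡.refl

module PolyRing where
  open CommutativeRing ℚ⟦x,y⟧.powerSeriesRing public
  open Derivations ℚ⟦x,y⟧.powerSeriesRing
  open ℚ⟦x,y⟧ using (coeffwise; coeff)
  open import Algebra.Properties.Semiring.Mult semiring using () renaming (_×_ to _×ₚ_)
  open import Relation.Binary.Reasoning.Setoid setoid

  pointwise : ∀ {f g : Poly} → (∀ i j → f i j ≡ g i j) → f ≈ g
  pointwise f≡g = coeffwise λ i → ℚ⟦y⟧.coeffwise (f≡g i)

  at : ∀ {f g : Poly} → f ≈ g → ∀ i j → f i j ≡ g i j
  at f≈g i j = ℚ⟦y⟧.coeff (coeff f≈g i) j

  *ₚ≈* : ∀ f g → f *ₚ g ≈ f * g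
  *ₚ≈* f g = pointwise λ i j →
    ≡.trans (Σ<≡∑ (suc i) _)
    (≡.trans (ℚ⟦y⟧.∑-cong (suc i) (λ a _ → Σ<≡∑ (suc j) _))
             (≡.sym (ℚ⟦y⟧.∑-pointwise (suc i) _ j)))

  ∂x≈d : ∀ f → ∂x f ≈ ℚ⟦x,y⟧.d f
  ∂x≈d f = pointwise λ i j →
    ≡.sym (≡.trans (ℚ⟦y⟧.×-pointwise (suc i) (f (suc i)) j) (×≡/1* (suc i) (f (suc i) j)))

  ∂y≈map-d : ∀ f → ∂y f ≈ ℚ⟦x,y⟧.map ℚ⟦y⟧.d f
  ∂y≈map-d f = pointwise λ i j → ≡.sym (×≡/1* (suc j) (f i (suc j)))

  D-expansion : ∀ f → D f ≈ X * Y * ∂x f + X * X * ∂y f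
  D-expansion f = begin
    D f                                    ≡⟨⟩
    (X *ₚ Y) *ₚ ∂x f + (X *ₚ X) *ₚ ∂y f    ≈⟨ +-cong (*ₚ≈* (X *ₚ Y) (∂x f)) (*ₚ≈* (X *ₚ X) (∂y f)) ⟩
    (X *ₚ Y) * ∂x f + (X *ₚ X) * ∂y f      ≈⟨ +-cong (*-congʳ {∂x f} (*ₚ≈* X Y)) (*-congʳ {∂y f} (*ₚ≈* X X)) ⟩
    X * Y * ∂x f + X * X * ∂y f            ∎

  D-isDerivation : IsDerivation D
  D-isDerivation = isDerivation-resp D≈
    (isDerivation-linearCombination (X * Y) (X * X) ℚ⟦x,y⟧.d-isDerivation
                                    (ℚ⟦x,y⟧.map-isDerivation ℚ⟦y⟧.d-isDerivation))
    where
    D≈ : ∀ f → X * Y * ℚ⟦x,y⟧.d f + X * X * ℚ⟦x,y⟧.map ℚ⟦y⟧.d f ≈ D f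
    D≈ f = begin
      X * Y * ℚ⟦x,y⟧.d f + X * X * ℚ⟦x,y⟧.map ℚ⟦y⟧.d f
        ≈⟨ +-cong (*-congˡ {X * Y} (∂x≈d f)) (*-congˡ {X * X} (∂y≈map-d f)) ⟨
      X * Y * ∂x f + X * X * ∂y f
        ≈⟨ D-expansion f ⟨
      D f
        ∎

  ∂x-X : ∂x X ≈ 1#
  ∂x-X = pointwise λ where
    zero    zero    → ≡.refl
    zero    (suc j) → ≡.refl
    (suc i) j       → ℚ.*-zeroʳ (+ suc (suc i) / 1)

  ∂y-X : ∂y X ≈ 0#
  ∂y-X = pointwise λ where
    zero          j → ℚ.*-zeroʳ (+ suc j / 1)
    (suc zero)    j → ℚ.*-zeroʳ (+ suc j / 1)
    (suc (suc i)) j → ℚ.*-zeroʳ (+ suc j / 1)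

  ∂x-Y : ∂x Y ≈ 0#
  ∂x-Y = pointwise λ i j → ℚ.*-zeroʳ (+ suc i / 1)

  ∂y-Y : ∂y Y ≈ 1#
  ∂y-Y = pointwise λ where
    zero    zero    → ≡.refl
    zero    (suc j) → ℚ.*-zeroʳ (+ suc (suc j) / 1)
    (suc i) zero    → ≡.refl
    (suc i) (suc j) → ℚ.*-zeroʳ (+ suc (suc j) / 1)

  D-X : D X ≈ X * Y
  D-X = begin
    D X                              ≈⟨ D-expansion X ⟩
    X * Y * ∂x X + X * X * ∂y X      ≈⟨ +-cong (*-congˡ {X * Y} ∂x-X) (*-congˡ {X * X} ∂y-X) ⟩
    X * Y * 1# + X * X * 0#          ≈⟨ +-cong (*-identityʳ (X * Y)) (zeroʳ (X * X)) ⟩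
    X * Y + 0#                       ≈⟨ +-identityʳ (X * Y) ⟩
    X * Y                            ∎

  D-Y : D Y ≈ X * X
  D-Y = begin
    D Y                              ≈⟨ D-expansion Y ⟩
    X * Y * ∂x Y + X * X * ∂y Y      ≈⟨ +-cong (*-congˡ {X * Y} ∂x-Y) (*-congˡ {X * X} ∂y-Y) ⟩
    X * Y * 0# + X * X * 1#          ≈⟨ +-cong (zeroʳ (X * Y)) (*-identityʳ (X * X)) ⟩
    0# + X * X                       ≈⟨ +-identityˡ (X * X) ⟩
    X * X                            ∎

  s²≈y²-x² : s² ≈ Y * Y - X * X
  s²≈y²-x² = begin
    s²                               ≡⟨⟩
    Y *ₚ Y + - (X *ₚ X)              ≈⟨ +-cong (*ₚ≈* Y Y) (-‿cong (*ₚ≈* X X)) ⟩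
    Y * Y - X * X                    ∎

  D-s² : D s² ≈ 0#
  D-s² = trans (IsDerivation.cong D-isDerivation s²≈y²-x²) (y²-x²-firstIntegral D-isDerivation X Y D-X D-Y)

  D-Y+s² : D Y + s² ≈ Y * Y
  D-Y+s² = begin
    D Y + s²                         ≈⟨ +-cong D-Y s²≈y²-x² ⟩
    X * X + (Y * Y - X * X)          ≈⟨ +-assoc (X * X) (Y * Y) (- (X * X)) ⟨
    X * X + Y * Y - X * X            ≈⟨ xyx⁻¹≈y (X * X) (Y * Y) ⟩
    Y * Y                            ∎
    where open import Algebra.Properties.AbelianGroup +-abelianGroup using (xyx⁻¹≈y)

  D^-cong : ∀ n {f g} → f ≈ g → D^ n f ≈ D^ n g
  D^-cong zero    f≈g = f≈g
  D^-cong (suc n) f≈g = IsDerivation.cong D-isDerivation (D^-cong n f≈g)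

  D^-+ : ∀ n f g → D^ n (f + g) ≈ D^ n f + D^ n g
  D^-+ zero    f g = refl
  D^-+ (suc n) f g = trans (IsDerivation.cong D-isDerivation (D^-+ n f g))
                           (IsDerivation.+-homo D-isDerivation (D^ n f) (D^ n g))

  D^-D : ∀ n f → D^ n (D f) ≡ D (D^ n f)
  D^-D zero    f = ≡.refl
  D^-D (suc n) f = ≡.cong D (D^-D n f)

  •≈const* : ∀ q f → q • f ≈ ℚ⟦x,y⟧.const (ℚ⟦y⟧.const q) * f
  •≈const* q f = pointwise λ i j → ≡.sym (≡.trans (ℚ⟦y⟧.coeff (coeff (ℚ⟦x,y⟧.const-⊛ (ℚ⟦y⟧.const q) f) i) j)
                                                  (ℚ⟦y⟧.coeff (ℚ⟦y⟧.const-⊛ q (f i)) j))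

  •-*ˡ : ∀ q a f → q • (a * f) ≈ a * (q • f)
  •-*ˡ q a f = begin
    q • (a * f)        ≈⟨ •≈const* q (a * f) ⟩
    κ * (a * f)        ≈⟨ x∙yz≈y∙xz κ a f ⟩
    a * (κ * f)        ≈⟨ *-congˡ {a} (•≈const* q f) ⟨
    a * (q • f)        ∎
    where
    open import Algebra.Properties.CommutativeSemigroup *-commutativeSemigroup using (x∙yz≈y∙xz)
    κ = ℚ⟦x,y⟧.const (ℚ⟦y⟧.const q)

  •-cong : ∀ q {f g} → f ≈ g → q • f ≈ q • g
  •-cong q f≈g = pointwise λ i j → ≡.cong (q ℚ.*_) (at f≈g i j)

  •-distrib-+ : ∀ q f g → q • (f + g) ≈ q • f + q • g
  •-distrib-+ q f g = pointwise λ i j → ℚ.*-distribˡ-+ q (f i j) (g i j)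

  •-zeroʳ : ∀ q → q • 0# ≈ 0#
  •-zeroʳ q = pointwise λ i j → ℚ.*-zeroʳ q

  inv!0•≈id : ∀ f → inv! 0 • f ≈ f
  inv!0•≈id f = pointwise λ i j → ℚ.*-identityˡ (f i j)

  suc×inv!• : ∀ n f → suc n ×ₚ (inv! (suc n) • f) ≈ inv! n • f
  suc×inv!• n f = pointwise λ i j →
    ≡.trans (ℚ⟦y⟧.coeff (ℚ⟦x,y⟧.×-pointwise (suc n) (inv! (suc n) • f) i) j)
            (≡.trans (ℚ⟦y⟧.×-pointwise (suc n) ((inv! (suc n) • f) i) j) (suc×[inv!*p]≡inv!*p n (f i j)))

  s·sinh≈s²*sinh/s : ∀ n → s·sinh-coeff n ≈ s² * sinh/s-coeff n
  s·sinh≈s²*sinh/s n with parity n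
  ... | even n%2≡0 _ _ rewrite n%2≡0 = sym (zeroʳ s²)
  ... | odd  n%2≡1 _ _ rewrite n%2≡1 = *ₚ≈* s² (s² ^ₚ ⌊ n /2⌋)

  1ₚ≈1# : 1ₚ ≈ 1#
  1ₚ≈1# = pointwise λ where
    zero    zero    → ≡.refl
    zero    (suc j) → ≡.refl
    (suc i) j       → ≡.refl

module SeriesRing where
  open CommutativeRing ℚ⟦x,y⟧⟦t⟧.powerSeriesRing
  open Derivations ℚ⟦x,y⟧⟦t⟧.powerSeriesRing
  open ℚ⟦x,y⟧⟦t⟧ using (coeffwise; coeff; d; const; d-const; d-isDerivation; const-⊛; ⊛-head;
                        IsExponentialOf; exponential-*-homo; exponential-const; ode-uniqueness)
  module P = PolyRing
  module ≈ₜ-Reasoning = Relation.Binary.Reasoning.Setoid setoid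
  module ≈ₚ-Reasoning = Relation.Binary.Reasoning.Setoid P.setoid

  ⋆≡* : ∀ F G n i j → (F ⋆ G) n i j ≡ (F * G) n i j
  ⋆≡* F G n i j =
    ≡.trans (Σ<≡∑ (suc n) _)
    (≡.trans (ℚ⟦y⟧.∑-cong (suc n) (λ k _ → P.at (P.*ₚ≈* (F k) (G (n ∸ k))) i j))
             (≡.sym (≡.trans (ℚ⟦y⟧.coeff (ℚ⟦x,y⟧.∑-pointwise (suc n) (λ k → F k P.* G (n ∸ k)) i) j)
                             (ℚ⟦y⟧.∑-pointwise (suc n) (λ k → (F k P.* G (n ∸ k)) i) j))))

  egf : (ℕ → Poly) → Series
  egf c n = inv! n • c n

  egf-cong : ∀ {c c′} → (∀ n → c n P.≈ c′ n) → egf c ≈ egf c′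
  egf-cong c≈c′ = coeffwise λ n → P.•-cong (inv! n) (c≈c′ n)

  egf-+ : ∀ c c′ → egf (λ n → c n P.+ c′ n) ≈ egf c + egf c′
  egf-+ c c′ = coeffwise λ n → P.•-distrib-+ (inv! n) (c n) (c′ n)

  d-egf : ∀ c → d (egf c) ≈ egf (c ∘ suc)
  d-egf c = coeffwise λ n → P.suc×inv!• n (c (suc n))

  egf-*ˡ : ∀ a c → egf (λ n → a P.* c n) ≈ const a * egf c
  egf-*ˡ a c = coeffwise λ n → P.trans (P.•-*ˡ (inv! n) a (c n)) (P.sym (coeff (const-⊛ a (egf c)) n))

  Gen-isExponential : IsExponentialOf D Gen
  Gen-isExponential = record
    { cong   = λ f≈g → egf-cong λ n → P.D^-cong n f≈g
    ; +-homo = λ f g → trans (egf-cong λ n → P.D^-+ n f g) (egf-+ (λ n → D^ n f) (λ n → D^ n g))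
    ; head   = P.inv!0•≈id
    ; d-homo = λ f → trans (d-egf (λ n → D^ n f)) (egf-cong λ n → P.reflexive (≡.sym (P.D^-D n f)))
    }

  Gen-*-homo : ∀ f g → Gen (f P.* g) ≈ Gen f * Gen g
  Gen-*-homo = exponential-*-homo Poly-torsionFree P.D-isDerivation Gen-isExponential

  Gen-const : ∀ {f} → D f P.≈ P.0# → Gen f ≈ const f
  Gen-const = exponential-const Poly-torsionFree P.D-isDerivation Gen-isExponential

  C S q y : Series
  C = egf cosh-coeff
  S = egf sinh/s-coeff
  q = const s²
  y = const Y

  coshS≈C : coshS ≈ C
  coeff coshS≈C n with n % 2
  ... | zero  = P.refl
  ... | suc _ = P.sym (P.•-zeroʳ (inv! n))

  sinhS/s≈S : sinhS/s ≈ S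
  coeff sinhS/s≈S n with n % 2
  ... | zero  = P.sym (P.•-zeroʳ (inv! n))
  ... | suc _ = P.refl

  egf-s·sinh≈q*S : egf s·sinh-coeff ≈ q * S
  egf-s·sinh≈q*S = trans (egf-cong P.s·sinh≈s²*sinh/s) (egf-*ˡ s² sinh/s-coeff)

  s·sinhS≈q*S : s·sinhS ≈ q * S
  s·sinhS≈q*S = trans (coeffwise s·sinhS≈egf) egf-s·sinh≈q*S
    where
    s·sinhS≈egf : ∀ n → s·sinhS n P.≈ egf s·sinh-coeff n
    s·sinhS≈egf n with n % 2
    ... | zero  = P.sym (P.•-zeroʳ (inv! n))
    ... | suc _ = P.refl

  d-C : d C ≈ q * S
  d-C = begin
    d C                       ≈⟨ d-egf cosh-coeff ⟩
    egf (cosh-coeff ∘ suc)    ≈⟨ egf-cong (λ n → P.reflexive (cosh-coeff-suc n)) ⟩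
    egf s·sinh-coeff          ≈⟨ egf-s·sinh≈q*S ⟩
    q * S                     ∎
    where open ≈ₜ-Reasoning

  d-S : d S ≈ C
  d-S = trans (d-egf sinh/s-coeff) (egf-cong (λ n → P.reflexive (sinh/s-coeff-suc n)))

  y*ₚ≈y* : ∀ F n → Y *ₚ F n P.≈ (y * F) n
  y*ₚ≈y* F n = P.trans (P.*ₚ≈* Y (F n)) (P.sym (coeff (const-⊛ Y F) n))

  Den≈C-yS : Den ≈ C - y * S
  Den≈C-yS = coeffwise λ n → P.+-cong (coeff coshS≈C n)
                                      (P.-‿cong (P.trans (y*ₚ≈y* sinhS/s n) (coeff (*-congˡ {y} sinhS/s≈S) n)))

  Num≈yC-qS : Num ≈ y * C - q * S
  Num≈yC-qS = coeffwise λ n → P.+-cong (P.trans (y*ₚ≈y* coshS n) (coeff (*-congˡ {y} coshS≈C) n))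
                                       (P.-‿cong (coeff s·sinhS≈q*S n))

  u v : Series
  u = C - y * S
  v = Gen Y

  d-u : d u ≈ q * S - y * C
  d-u = ∂[C-yS] d-isDerivation {q} {y} {C} {S} (d-const s²) (d-const Y) d-C d-S

  d-d-u : d (d u) ≈ q * u
  d-d-u = ∂∂[C-yS] d-isDerivation {q} {y} {C} {S} (d-const s²) (d-const Y) d-C d-S

  d-v : d v + q ≈ v * v
  d-v = begin
    d v + q               ≈⟨ +-cong (d-homo Y) (sym (Gen-const P.D-s²)) ⟩
    Gen (D Y) + Gen s²    ≈⟨ +-homo (D Y) s² ⟨
    Gen (D Y P.+ s²)      ≈⟨ cong P.D-Y+s² ⟩
    Gen (Y P.* Y)         ≈⟨ Gen-*-homo Y Y ⟩
    v * v                 ∎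
    where
    open IsExponentialOf Gen-isExponential
    open ≈ₜ-Reasoning

  C₀ : C 0 P.≈ P.1#
  C₀ = P.trans (P.inv!0•≈id 1ₚ) P.1ₚ≈1#

  S₀ : S 0 P.≈ P.0#
  S₀ = P.inv!0•≈id 0ₚ

  u₀ : u 0 P.≈ P.1#
  u₀ = begin
    C 0 P.- (y * S) 0           ≈⟨ P.+-cong C₀ (P.-‿cong (⊛-head y S)) ⟩
    P.1# P.- Y P.* S 0          ≈⟨ P.+-congˡ {P.1#} (P.-‿cong (P.trans (P.*-congˡ {Y} S₀) (P.zeroʳ Y))) ⟩
    P.1# P.- P.0#               ≈⟨ P.+-congˡ {P.1#} -0#≈0# ⟩
    P.1# P.+ P.0#               ≈⟨ P.+-identityʳ P.1# ⟩
    P.1#                        ∎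
    where
    open ≈ₚ-Reasoning
    open import Algebra.Properties.Ring P.ring using (-0#≈0#)

  d-u₀ : d u 0 P.≈ P.- Y
  d-u₀ = begin
    d u 0                          ≈⟨ coeff d-u 0 ⟩
    (q * S) 0 P.- (y * C) 0        ≈⟨ P.+-cong (⊛-head q S) (P.-‿cong (⊛-head y C)) ⟩
    s² P.* S 0 P.- Y P.* C 0       ≈⟨ P.+-cong (P.*-congˡ {s²} S₀) (P.-‿cong (P.*-congˡ {Y} C₀)) ⟩
    s² P.* P.0# P.- Y P.* P.1#     ≈⟨ P.+-cong (P.zeroʳ s²) (P.-‿cong (P.*-identityʳ Y)) ⟩
    P.0# P.- Y                     ≈⟨ P.+-identityˡ (P.- Y) ⟩
    P.- Y                          ∎
    where open ≈ₚ-Reasoning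

  E : Series
  E = v * u + d u

  E₀ : E 0 P.≈ P.0#
  E₀ = begin
    (v * u) 0 P.+ d u 0        ≈⟨ P.+-cong (⊛-head v u) d-u₀ ⟩
    v 0 P.* u 0 P.+ P.- Y      ≈⟨ P.+-congʳ {P.- Y} (P.*-cong (IsExponentialOf.head Gen-isExponential Y) u₀) ⟩
    Y P.* P.1# P.+ P.- Y       ≈⟨ P.+-congʳ {P.- Y} (P.*-identityʳ Y) ⟩
    Y P.- Y                    ≈⟨ P.-‿inverseʳ Y ⟩
    P.0#                       ∎
    where open ≈ₚ-Reasoning

  E≈0 : E ≈ 0#
  E≈0 = ode-uniqueness Poly-torsionFree v E₀ (riccati d-isDerivation q v u d-v d-d-u)

  v*Den≈Num : v * Den ≈ Num
  v*Den≈Num = begin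
    v * Den               ≈⟨ *-congˡ {v} Den≈C-yS ⟩
    v * u                 ≈⟨ inverseˡ-unique (v * u) (d u) E≈0 ⟩
    - d u                 ≈⟨ -‿cong d-u ⟩
    - (q * S - y * C)     ≈⟨ ⁻¹-anti-homo‿- (q * S) (y * C) ⟩
    y * C - q * S         ≈⟨ Num≈yC-qS ⟨
    Num                   ∎
    where
    open ≈ₜ-Reasoning
    open import Algebra.Properties.Group +-group using (inverseˡ-unique)
    open import Algebra.Properties.AbelianGroup +-abelianGroup using (⁻¹-anti-homo‿-)

corollary2p5 : ∀ (n i j : ℕ) → (Gen Y ⋆ Den) n i j ≡ Num n i j
corollary2p5 n i j = ≡.trans (⋆≡* (Gen Y) Den n i j) (PolyRing.at (ℚ⟦x,y⟧⟦t⟧.coeff v*Den≈Num n) i j)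
  where open SeriesRing
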